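{- Let $T$ be a tree on $t$ vertices. (a) There is a vertex $z\in V(T)$ such that every component of $T-z$ has at most $t/2$ vertices. (b) Let $z$ be a vertex as in (a). Then for any $t'<\frac{t}{2}$, either every component of $T-z$ has fewer than $t'$ vertices, or there is a vertex $v_{t'}$ of $T-z$ such that the component of $T-v_{t'}$ containing $z$ has at most $t-t'$ vertices and every other component of $T-v_{t'}$ has fewer than $t'$ vertices. -}

module Defs where

open import Level using (0ℓ)
open import Data.Nat using (ℕ; _≤_; _<_; _*_; _∸_)
open import Data.Sum using (_⊎_)
open import Data.Fin using (Fin)
open import Data.List using (List; []; _∷_; _++_; length)
open import Data.List.Relation.Unary.All using (All)
open import Data.List.Relation.Unary.Unique.Propositional using (Unique)
open import Data.List.Relation.Unary.Linked using (Linked)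
open import Data.Product using (Σ; _×_; ∃)
open import Data.Unit using (⊤)
open import Relation.Nullary using (¬_)
open import Relation.Binary.PropositionalEquality using (_≡_; _≢_)

record Graph (t : ℕ) : Set₁ where
  field
    Adj    : Fin t → Fin t → Set
    sym    : ∀ {u v} → Adj u v → Adj v u
    irrefl : ∀ {u} → ¬ Adj u u
open Graph public

module _ {t : ℕ} (G : Graph t) where

  data Walk (P : Fin t → Set) : Fin t → Fin t → Set where
    nil  : ∀ {u} → P u → Walk P u u
    cons : ∀ {u v w} → P u → Adj G u v → Walk P v w → Walk P u w

  Connected : Set
  Connected = ∀ u v → Walk (λ _ → ⊤) u v

  Cycle : Set
  Cycle = Σ (Fin t) λ x → Σ (List (Fin t)) λ xs →
            Unique (x ∷ xs) × 2 ≤ length xs × Linked (Adj G) (x ∷ xs ++ x ∷ [])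

  IsTree : Set
  IsTree = 0 < t × Connected × ¬ Cycle

  Del : Fin t → Fin t → Set
  Del z w = w ≢ z

  Comp : (z u : Fin t) → Fin t → Set
  Comp z u w = Walk (Del z) u w

-- |S| ≤ k for a subset S of Fin t: every duplicate-free list of
-- elements of S has length at most k.
AtMost : {t : ℕ} → (Fin t → Set) → ℕ → Set
AtMost {t} S k = (xs : List (Fin t)) → Unique xs → All S xs → length xs ≤ k

FewerThan : {t : ℕ} → (Fin t → Set) → ℕ → Set
FewerThan {t} S k = (xs : List (Fin t)) → Unique xs → All S xs → length xs < k

-- |S| ≤ t/2, i.e. 2·|S| ≤ t.
AtMostHalf : {t : ℕ} → (Fin t → Set) → ℕ → Set
AtMostHalf {t} S m = (xs : List (Fin t)) → Unique xs → All S xs → 2 * length xs ≤ m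

Balanced : {t : ℕ} → Graph t → Fin t → Set
Balanced {t} T z = ∀ u → u ≢ z → AtMostHalf (Comp T z u) t

PartB : {t : ℕ} → Graph t → Fin t → ℕ → Set
PartB {t} T z t' =
    (∀ u → u ≢ z → FewerThan (Comp T z u) t')
  ⊎ Σ (Fin t) λ v → v ≢ z
      × AtMost (Comp T v z) (t ∸ t')
      × (∀ u → u ≢ v → ¬ Comp T v u z → FewerThan (Comp T v u) t')

module Submission where

-- (a) Start anywhere and step towards a component C of T − z with more than t/2
-- vertices, into its vertex a adjacent to z. In T − a the component containing z
-- has t − |C| < t/2 vertices and every other one lies strictly inside C, so the
-- largest heavy component shrinks and the walk stops at a balanced vertex.
--
-- (b) holds for every vertex z and every t′. Enter a component C of T − z with at
-- least t′ vertices, then keep stepping into a component of T − v that avoids z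
-- and has at least t′ vertices. Each step crosses an edge into such a component C,
-- after which the component containing z has t − |C| ≤ t − t′ vertices; it grows
-- at every step, so the search ends at the required vertex.

open import Defs renaming (sym to Adj-sym)
open import Level using (0ℓ)
open import Data.Nat using (ℕ; zero; suc; _<_; _*_; _≤_; _+_; _∸_; z≤n; s≤s; _<?_; _≤?_)
open import Data.Nat.Properties
  using (≤-trans; ≤-pred; <-≤-trans; ≤-<-trans; <-irrefl; ≮⇒≥; ≰⇒>; n≮0; m≤n+m;
         +-identityʳ; +-suc; +-monoˡ-≤; +-mono-<;
         *-monoʳ-≤; *-distribˡ-+; ∸-monoʳ-≤; m+n∸m≡n; ≤-antisym; module ≤-Reasoning)
open import Data.Fin using (Fin; _≟_; fromℕ<)
open import Data.Fin.Properties using (any?)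
open import Data.Product using (Σ; _×_; _,_; proj₁; proj₂; ∃)
open import Data.Sum using (_⊎_; inj₁; inj₂; fromInj₂)
open import Data.List using (List; []; _∷_; _++_; length; filter; allFin)
open import Data.List.Properties using (length-filter; length-removeAt′; length-tabulate)
open import Data.List.Relation.Unary.All as All using (All; []; _∷_)
open import Data.List.Relation.Unary.All.Properties using (¬Any⇒All¬; all-filter)
open import Data.List.Relation.Unary.Any using (here; there; index)
open import Data.List.Membership.Propositional using (_∈_; _─_)
open import Data.List.Membership.Propositional.Properties using (∈-filter⁺; ∈-allFin)
open import Data.List.Relation.Unary.Unique.Propositional using (Unique)
open import Data.List.Relation.Unary.Unique.Propositional.Properties using (filter⁺; allFin⁺)
open import Data.List.Relation.Unary.AllPairs using ([]; _∷_)
open import Data.List.Relation.Unary.Linked using (Linked; [-]; _∷_)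
open import Relation.Nullary using (¬_; yes; no; contradiction)
open import Relation.Nullary.Decidable using (¬?; _×-dec_)
open import Relation.Unary using (Pred; Decidable; _⊆_; _∩_; ∁)
open import Relation.Unary.Properties using (∁?)
open import Relation.Binary.PropositionalEquality
  using (_≡_; _≢_; ≢-sym; refl; sym; trans; cong; subst; subst₂; module ≡-Reasoning)

module _ {A : Set} where

  ∈-─⁺ : ∀ {x y} {ys : List A} (x∈ys : x ∈ ys) → y ∈ ys → y ≢ x → y ∈ ys ─ x∈ys
  ∈-─⁺ (here refl)  (here refl)  y≢x = contradiction refl y≢x
  ∈-─⁺ (here refl)  (there y∈ys) _   = y∈ys
  ∈-─⁺ (there _)    (here refl)  _   = here refl
  ∈-─⁺ (there x∈ys) (there y∈ys) y≢x = there (∈-─⁺ x∈ys y∈ys y≢x)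

  unique-⊆⇒length≤ : ∀ {xs ys : List A} → Unique xs → (∀ {x} → x ∈ xs → x ∈ ys) →
                      length xs ≤ length ys
  unique-⊆⇒length≤ {[]}          _            _     = z≤n
  unique-⊆⇒length≤ {x ∷ xs} {ys} (x∉xs ∷ xs!) xs⊆ys = begin
    suc (length xs)          ≤⟨ s≤s (unique-⊆⇒length≤ xs! xs⊆ys─x) ⟩
    suc (length (ys ─ x∈ys)) ≡⟨ sym (length-removeAt′ ys (index x∈ys)) ⟩
    length ys                ∎
    where
    open ≤-Reasoning
    x∈ys : x ∈ ys
    x∈ys = xs⊆ys (here refl)
    xs⊆ys─x : ∀ {y} → y ∈ xs → y ∈ ys ─ x∈ys
    xs⊆ys─x y∈xs = ∈-─⁺ x∈ys (xs⊆ys (there y∈xs)) (λ y≡x → All.lookup x∉xs y∈xs (sym y≡x))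

  length-filter+length-filter-∁ : ∀ {P : Pred A 0ℓ} (P? : Decidable P) xs →
    length (filter P? xs) + length (filter (∁? P?) xs) ≡ length xs
  length-filter+length-filter-∁ P? []       = refl
  length-filter+length-filter-∁ P? (x ∷ xs) with P? x
  ... | yes _ = cong suc (length-filter+length-filter-∁ P? xs)
  ... | no  _ = trans (+-suc _ _) (cong suc (length-filter+length-filter-∁ P? xs))

module _ {t : ℕ} where

  count : {P : Pred (Fin t) 0ℓ} → Decidable P → ℕ
  count P? = length (filter P? (allFin t))

  module _ {P : Pred (Fin t) 0ℓ} (P? : Decidable P) where

    atMost-count : AtMost P (count P?)
    atMost-count xs xs! Pxs =
      unique-⊆⇒length≤ xs! (λ x∈xs → ∈-filter⁺ P? (∈-allFin _) (All.lookup Pxs x∈xs))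

    count≤ : count P? ≤ t
    count≤ = subst (count P? ≤_) (length-tabulate _) (length-filter P? (allFin t))

    count+count-∁ : count P? + count (∁? P?) ≡ t
    count+count-∁ = trans (length-filter+length-filter-∁ P? (allFin t)) (length-tabulate _)

  module _ {P Q : Pred (Fin t) 0ℓ} (P? : Decidable P) (Q? : Decidable Q) where

    count-mono : P ⊆ Q → count P? ≤ count Q?
    count-mono P⊆Q =
      atMost-count Q? _ (filter⁺ P? (allFin⁺ t)) (All.map P⊆Q (all-filter P? (allFin t)))

    count-mono-< : P ⊆ Q → ∀ {x} → Q x → ¬ P x → count P? < count Q?
    count-mono-< P⊆Q {x} Qx ¬Px =
      atMost-count Q? (x ∷ filter P? (allFin t))
        (x∉ ∷ filter⁺ P? (allFin⁺ t)) (Qx ∷ All.map P⊆Q (all-filter P? (allFin t)))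
      where
      x∉ : All (x ≢_) (filter P? (allFin t))
      x∉ = All.map (λ Py x≡y → ¬Px (subst P (sym x≡y) Py)) (all-filter P? (allFin t))

  count-cong : ∀ {P Q : Pred (Fin t) 0ℓ} (P? : Decidable P) (Q? : Decidable Q) →
               P ⊆ Q → Q ⊆ P → count P? ≡ count Q?
  count-cong P? Q? P⊆Q Q⊆P = ≤-antisym (count-mono P? Q? P⊆Q) (count-mono Q? P? Q⊆P)

no-two-majorities : ∀ {t m n} → t < 2 * m → t < 2 * n → m + n ≢ t
no-two-majorities {t} {m} {n} tm tn m+n≡t = <-irrefl refl (begin-strict
  t + t          <⟨ +-mono-< tm tn ⟩
  2 * m + 2 * n  ≡⟨ *-distribˡ-+ 2 m n ⟨
  2 * (m + n)    ≡⟨ cong (2 *_) m+n≡t ⟩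
  2 * t          ≡⟨ cong (t +_) (+-identityʳ t) ⟩
  t + t          ∎)
  where open ≤-Reasoning

module Walks {t : ℕ} (G : Graph t) where
  open import Data.List.Membership.DecPropositional (_≟_ {t}) using (_∈?_)

  private
    variable
      P Q : Pred (Fin t) 0ℓ
      u v w x y z : Fin t

  weaken : P ⊆ Q → Walk G P u v → Walk G Q u v
  weaken P⊆Q (nil Pu)        = nil (P⊆Q Pu)
  weaken P⊆Q (cons Pu uv vw) = cons (P⊆Q Pu) uv (weaken P⊆Q vw)

  source : Walk G P u v → P u
  source (nil Pu)      = Pu
  source (cons Pu _ _) = Pu

  target : Walk G P u v → P v
  target (nil Pv)      = Pv
  target (cons _ _ vw) = target vw

  infixr 5 _++ʷ_
  _++ʷ_ : Walk G P u v → Walk G P v w → Walk G P u w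
  nil _        ++ʷ vw = vw
  cons Pu e uv ++ʷ vw = cons Pu e (uv ++ʷ vw)

  reverse : Walk G P u v → Walk G P v u
  reverse (nil Pu)        = nil Pu
  reverse (cons Pu uv vw) = reverse vw ++ʷ cons (source vw) (Adj-sym G uv) (nil Pu)

  avoid-or-last-visit : ∀ z → Walk G P x y → y ≢ z →
    Walk G (P ∩ Del G z) x y ⊎ ∃ λ c → Adj G z c × Walk G (P ∩ Del G z) c y
  avoid-or-last-visit z (nil Px) y≢z = inj₁ (nil (Px , y≢z))
  avoid-or-last-visit z (cons {x} {v} Px xv vy) y≢z with avoid-or-last-visit z vy y≢z
  ... | inj₂ tail = inj₂ tail
  ... | inj₁ vy′ with x ≟ z
  ...   | yes refl = inj₂ (v , xv , vy′)
  ...   | no x≢z   = inj₁ (cons (Px , x≢z) xv vy′)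

  vertices : Walk G P u v → List (Fin t)
  vertices (nil {u} _)      = u ∷ []
  vertices (cons {u} _ _ w) = u ∷ vertices w

  All-vertices : (w : Walk G P u v) → All P (vertices w)
  All-vertices (nil Pu)      = Pu ∷ []
  All-vertices (cons Pu _ w) = Pu ∷ All-vertices w

  Path : Pred (Fin t) 0ℓ → Fin t → Fin t → Set
  Path P u v = Σ (Walk G P u v) λ w → Unique (vertices w)

  suffix : (w : Walk G P v y) → Unique (vertices w) → u ∈ vertices w → Path P u y
  suffix w@(nil _)      w!       (here refl) = w , w!
  suffix w@(cons _ _ _) w!       (here refl) = w , w!
  suffix (cons _ _ w)   (_ ∷ w!) (there u∈w) = suffix w w! u∈w

  toPath : Walk G P u v → Path P u v
  toPath (nil Pu) = nil Pu , [] ∷ []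
  toPath (cons {u} Pu uv w) with toPath w
  ... | p , p! with u ∈? vertices p
  ...   | yes u∈p = suffix p p! u∈p
  ...   | no  u∉p = cons Pu uv p , ¬Any⇒All¬ _ u∉p ∷ p!

  2≤length-vertices : u ≢ v → (w : Walk G P u v) → 2 ≤ length (vertices w)
  2≤length-vertices u≢u (nil _)                 = contradiction refl u≢u
  2≤length-vertices _   (cons _ _ (nil _))        = s≤s (s≤s z≤n)
  2≤length-vertices _   (cons _ _ (cons _ _ _))   = s≤s (s≤s z≤n)

  linked-between : Adj G x u → (w : Walk G P u v) → Adj G v y →
                   Linked (Adj G) (x ∷ vertices w ++ y ∷ [])
  linked-between xu (nil _)       uy = xu ∷ uy ∷ [-]
  linked-between xu (cons _ uv w) wy = xu ∷ linked-between uv w wy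

  cycle-through : Adj G z u → Adj G z v → u ≢ v → Walk G (Del G z) u v → Cycle G
  cycle-through {z} zu zv u≢v w with toPath w
  ... | p , p! = z , vertices p
               , All.map ≢-sym (All-vertices p) ∷ p!
               , 2≤length-vertices u≢v p
               , linked-between zu p (Adj-sym G zv)

module TreeComponents {t : ℕ} (T : Graph t) (tree : IsTree T) where
  open Walks T

  private
    variable
      u v w z a b : Fin t

    connected : Connected T
    connected = proj₁ (proj₂ tree)

    acyclic : ¬ Cycle T
    acyclic = proj₂ (proj₂ tree)

  adj⇒≢ : Adj T z a → a ≢ z
  adj⇒≢ {z} za a≡z = irrefl T (subst (Adj T z) a≡z za)

  no-detour : Adj T z a → Adj T z b → a ≢ b → ¬ Walk T (Del T z) a b
  no-detour za zb a≢b ab = acyclic (cycle-through za zb a≢b ab)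

  component-neighbour : u ≢ z → ∃ λ a → Adj T z a × Comp T z a u
  component-neighbour {u} {z} u≢z with avoid-or-last-visit z (connected z u) u≢z
  ... | inj₁ zu            = contradiction refl (proj₂ (source zu))
  ... | inj₂ (a , za , au) = a , za , weaken proj₂ au

  edge-split : Adj T z a → ∀ w → Comp T z a w ⊎ Comp T a z w
  edge-split {z} {a} za w with w ≟ z
  ... | yes refl = inj₂ (nil (≢-sym (adj⇒≢ za)))
  ... | no w≢z with avoid-or-last-visit z (connected a w) w≢z
  ...   | inj₁ aw = inj₁ (weaken proj₂ aw)
  ...   | inj₂ (c , zc , cw) with w ≟ a
  ...     | yes refl = inj₁ (nil (adj⇒≢ za))
  ...     | no w≢a with avoid-or-last-visit a cw w≢a
  ...       | inj₁ cw′          = inj₂ (cons (≢-sym (adj⇒≢ za)) zc (weaken proj₂ cw′))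
  ...       | inj₂ (d , ad , dw) = inj₁ (cons (adj⇒≢ za) ad (weaken (λ p → proj₂ (proj₁ p)) dw))

  edge-disjoint : Adj T z a → Comp T z a w → ¬ Comp T a z w
  edge-disjoint {z} za aw zw with avoid-or-last-visit z zw (target aw)
  ... | inj₁ zw′           = proj₂ (source zw′) refl
  ... | inj₂ (c , zc , cw) =
    no-detour za zc (≢-sym (proj₁ (source cw))) (aw ++ʷ reverse (weaken proj₂ cw))

  branch⊆ : Adj T z a → Adj T a b → b ≢ z → Comp T a b ⊆ Comp T z a
  branch⊆ za ab b≢z {w} bw with edge-split za w
  ... | inj₁ aw = aw
  ... | inj₂ zw = contradiction (zw ++ʷ reverse bw) (no-detour (Adj-sym T za) ab (≢-sym b≢z))

  comp? : ∀ z u → Decidable (Comp T z u)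
  comp? z u w with u ≟ z
  ... | yes refl = no (λ uw → source uw refl)
  ... | no u≢z with component-neighbour u≢z
  ...   | a , za , au with edge-split za w
  ...     | inj₁ aw = yes (reverse au ++ʷ aw)
  ...     | inj₂ zw = no (λ uw → edge-disjoint za (au ++ʷ uw) zw)

  size : Fin t → Fin t → ℕ
  size z u = count (comp? z u)

  size-cong : Comp T z u v → size z u ≡ size z v
  size-cong uv = count-cong (comp? _ _) (comp? _ _) (reverse uv ++ʷ_) (uv ++ʷ_)

  size-edge : Adj T z a → size z a + size a z ≡ t
  size-edge {z} {a} za = begin
    size z a + size a z                        ≡⟨ cong (size z a +_) az≡∁za ⟩
    count (comp? z a) + count (∁? (comp? z a)) ≡⟨ count+count-∁ (comp? z a) ⟩
    t                                          ∎
    where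
    open ≡-Reasoning
    az⊆∁za : Comp T a z ⊆ ∁ (Comp T z a)
    az⊆∁za zw aw = edge-disjoint za aw zw
    ∁za⊆az : ∁ (Comp T z a) ⊆ Comp T a z
    ∁za⊆az {w} ¬aw = fromInj₂ (λ aw → contradiction aw ¬aw) (edge-split za w)
    az≡∁za : size a z ≡ count (∁? (comp? z a))
    az≡∁za = count-cong (comp? a z) (∁? (comp? z a)) az⊆∁za ∁za⊆az

  size-across : Adj T z a → Comp T a z w → size a w ≡ t ∸ size z a
  size-across {z} {a} {w} za zw = begin
    size a w                       ≡⟨ size-cong zw ⟨
    size a z                       ≡⟨ m+n∸m≡n (size z a) (size a z) ⟨
    size z a + size a z ∸ size z a ≡⟨ cong (_∸ size z a) (size-edge za) ⟩
    t ∸ size z a                   ∎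
    where open ≡-Reasoning

  size-branch< : Adj T z a → Adj T a b → b ≢ z → size a b < size z a
  size-branch< za ab b≢z =
    count-mono-< (comp? _ _) (comp? _ _) (branch⊆ za ab b≢z)
      (nil (adj⇒≢ za)) (λ ba → target ba refl)

  Heavy : Fin t → Pred (Fin t) 0ℓ
  Heavy z u = u ≢ z × t < 2 * size z u

  heavy? : ∀ z → Decidable (Heavy z)
  heavy? z u = ¬? (u ≟ z) ×-dec (t <? 2 * size z u)

  heavy-shrinks : Adj T z a → Comp T z a u → Heavy z u → Heavy a v → size a v < size z u
  heavy-shrinks {z} {a} za au (_ , zu-heavy) (v≢a , av-heavy) with component-neighbour v≢a
  ... | b , ab , bv with b ≟ z
  ...   | yes refl = contradiction (size-edge za) (no-two-majorities {m = size z a} za-heavy az-heavy)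
    where
    za-heavy : t < 2 * size z a
    za-heavy = subst (λ s → t < 2 * s) (sym (size-cong au)) zu-heavy
    az-heavy : t < 2 * size a z
    az-heavy = subst (λ s → t < 2 * s) (sym (size-cong bv)) av-heavy
  ...   | no b≢z = subst₂ _<_ (size-cong bv) (size-cong au) (size-branch< za ab b≢z)

  balanced-below : ∀ n z → (∀ {u} → Heavy z u → size z u < n) →
                   ∃ λ z → ∀ u → u ≢ z → 2 * size z u ≤ t
  balanced-below n z bound with any? (heavy? z)
  ... | no ¬heavy = z , λ u u≢z → ≮⇒≥ (λ big → ¬heavy (u , u≢z , big))
  balanced-below zero    z bound | yes (_ , heavy) = contradiction (bound heavy) n≮0
  balanced-below (suc n) z bound | yes (u , heavy) with component-neighbour (proj₁ heavy)
  ... | a , za , au =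
    balanced-below n a λ heavy′ →
      <-≤-trans (heavy-shrinks za au heavy heavy′) (≤-pred (bound heavy))

  balanced-vertex : ∃ λ z → Balanced T z
  balanced-vertex with balanced-below (suc t) (fromℕ< (proj₁ tree)) (λ _ → s≤s (count≤ _))
  ... | z , balanced =
    z , λ u u≢z xs xs! Cxs → ≤-trans (*-monoʳ-≤ 2 (atMost-count _ xs xs! Cxs)) (balanced u u≢z)

  module _ (z : Fin t) (t′ : ℕ) where

    Large : Fin t → Pred (Fin t) 0ℓ
    Large v u = u ≢ v × ¬ Comp T v u z × t′ ≤ size v u

    large? : ∀ v → Decidable (Large v)
    large? v u = ¬? (u ≟ v) ×-dec ¬? (comp? v u z) ×-dec (t′ ≤? size v u)

    Candidate : Pred (Fin t) 0ℓ
    Candidate v = v ≢ z × size v z ≤ t ∸ t′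

    across-large : Adj T v b → Comp T v b u → t′ ≤ size v u → Comp T b v z → size b z ≤ t ∸ t′
    across-large vb bu large bz =
      subst (_≤ t ∸ t′) (sym (size-across vb bz))
        (∸-monoʳ-≤ t (subst (t′ ≤_) (sym (size-cong bu)) large))

    large-step : Candidate v → Large v u → ∃ λ b → Candidate b × size v z < size b z
    large-step {v} (v≢z , _) (u≢v , ¬uz , large)
      with component-neighbour u≢v | component-neighbour (≢-sym v≢z)
    ... | b , vb , bu | c , vc , cz = b , (b≢z , across-large vb bu large bz) , grows
      where
      ¬bz : ¬ Comp T v b z
      ¬bz bz = ¬uz (reverse bu ++ʷ bz)
      b≢z : b ≢ z
      b≢z refl = ¬bz (nil (adj⇒≢ vb))
      bz : Comp T b v z
      bz = fromInj₂ (λ bz → contradiction bz ¬bz) (edge-split vb z)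
      c≢b : c ≢ b
      c≢b refl = ¬bz cz
      grows : size v z < size b z
      grows = subst₂ _<_ (size-cong cz) (size-cong bz) (size-branch< (Adj-sym T vb) vc c≢b)

    -- size v z strictly grows along the search and never exceeds t.
    settle : ∀ n v → Candidate v → t < size v z + n → ∃ λ v → Candidate v × ∀ u → ¬ Large v u
    settle n v cand fuel with any? (large? v)
    ... | no ¬large = v , cand , λ u large → ¬large (u , large)
    settle zero v _ fuel | yes _ =
      contradiction (≤-<-trans (count≤ _) (subst (t <_) (+-identityʳ _) fuel)) (<-irrefl refl)
    settle (suc n) v cand fuel | yes (_ , large) with large-step cand large
    ... | b , cand′ , grows = settle n b cand′ (<-≤-trans fuel (begin
      size v z + suc n   ≡⟨ +-suc (size v z) n ⟩
      suc (size v z) + n ≤⟨ +-monoˡ-≤ n grows ⟩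
      size b z + n       ∎))
      where open ≤-Reasoning

    partB-holds : PartB T z t′
    partB-holds with any? (large? z)
    ... | no ¬large = inj₁ λ u u≢z xs xs! Cxs →
      ≤-<-trans (atMost-count _ xs xs! Cxs)
        (≰⇒> λ big → ¬large (u , u≢z , (λ zz → target zz refl) , big))
    ... | yes (u , u≢z , _ , big) with component-neighbour u≢z
    ...   | a , za , au
      with settle (suc t) a (adj⇒≢ za , across-large za au big (nil (≢-sym (adj⇒≢ za))))
                  (m≤n+m (suc t) (size a z))
    ...     | v , (v≢z , bound) , settled = inj₂ (v , v≢z , at-most , fewer)
      where
      at-most : AtMost (Comp T v z) (t ∸ t′)
      at-most xs xs! Cxs = ≤-trans (atMost-count _ xs xs! Cxs) bound
      fewer : ∀ u → u ≢ v → ¬ Comp T v u z → FewerThan (Comp T v u) t′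
      fewer u u≢v ¬uz xs xs! Cxs =
        ≤-<-trans (atMost-count _ xs xs! Cxs) (≰⇒> λ big → settled u (u≢v , ¬uz , big))

mainTheorem5 : (t : ℕ) (T : Graph t) → IsTree T →
    Σ (Fin t) (λ z → Balanced T z)
    × ((z : Fin t) → Balanced T z → (t' : ℕ) → 2 * t' < t → PartB T z t')
mainTheorem5 t T tree = balanced-vertex , λ z _ t′ _ → partB-holds z t′
  where open TreeComponents T tree
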